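{- Let $\mathcal F$ be a family of dangers and let $r\ge1$ be an integer. Then for every marked hypergraph $H$ with $|V(H)\setminus M(H)|\ge 2r$, the properties $J_r(\mathcal F,H)$ and $J_1(\mathcal F^{*(r-1)},H)$ are equivalent.
   Context: A marked hypergraph $H$: finite nonempty $V(H)$, edge set $E(H)$ of nonempty subsets of $V(H)$, marked set $M(H)\subseteq V(H)$. Subhypergraph $X$: $V(X)\subseteq V(H)$, $E(X)\subseteq E(H)$, $M(X)=V(X)\cap M(H)$. $H^{+x}$ marks non-marked $x$ ($X^{+x}=X$ if $x\notin V(X)$); $H^{ -y}$ deletes $y$ and all edges containing it. Maker win (recursive): if $|V(H)\setminus M(H)|\le1$, iff some edge $e$ has $|e\setminus M(H)|\le1$; otherwise iff some non-marked $x$ has $H^{+x-y}$ a Maker win for all non-marked $y\ne x$. Pointed marked hypergraph $(D,x)$: $x\in V(D)\setminus M(D)$; isomorphism preserves edges, marks, point. A family of dangers is a family $\mathcal F$ of pointed marked hypergraphs with $D^{+x}$ a Maker win for each $(D,x)\in\mathcal F$. $x\mathcal F(H)$: subhypergraphs $X\ni x$ of $H$ with $(X,x)$ isomorphic to a member of $\mathcal F$. $\mathrm{Int}_H(\mathcal X)$: non-marked vertices of $H$ in every member of $\mathcal X$. $J_1(\mathcal F,H)$: for every non-marked $x$, $\mathrm{Int}_{H^{+x}}(x\mathcal F(H))\ne\varnothing$; $J_r(\mathcal F,H)$ ($r\ge2$): for every non-marked $x$ there is $y\in\mathrm{Int}_{H^{+x}}(x\mathcal F(H))$ with $J_{r-1}(\mathcal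 F,H^{+x-y})$. $\mathrm{obs}(\mathcal F)$: all $(D,x)$ for which there exist $z\in V(D)\setminus(M(D)\cup\{x\})$ and a collection $\mathcal O$ of subhypergraphs of $D$ whose union (vertices, edges, marks) is $D$, such that every $X\in\mathcal O$ contains $z$ with $(X^{+x},z)$ isomorphic to a member of $\mathcal F$, and $\mathrm{Int}_{D^{+x+z}}(\mathcal O)=\varnothing$. $\mathcal F^{*0}=\mathcal F$, $\mathcal F^{*r}=\mathcal F\cup\mathrm{obs}(\mathcal F^{*(r-1)})$. -}

module Defs where

open import Data.Nat using (ℕ; zero; suc; _≤_)
open import Data.Bool using (Bool; true; false; _∧_; not; if_then_else_)
open import Data.Fin using (Fin)
open import Data.Fin.Subset
  using (Subset; ⁅_⁆; _∈_; _∉_; _⊆_; ∁; _∩_; _∪_; _─_; ⋃; ∣_∣; Nonempty)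
  renaming (⊥ to ∅)
open import Data.Vec using (lookup)
open import Data.List using (List; allFin; map)
open import Data.List.Membership.Propositional using () renaming (_∈_ to _∈ₗ_)
open import Data.Product using (Σ; _×_; ∃; ∃-syntax)
open import Data.Sum using (_⊎_)
open import Data.Unit using (⊤)
open import Relation.Nullary using (¬_)
open import Relation.Binary.PropositionalEquality using (_≡_; _≢_)
open import Function.Bundles using (_⇔_)

-- Marked hypergraphs with vertices drawn from the universe Fin n.  Well-formedness is the separate predicate IsMH.

record MH (n : ℕ) : Set where
  constructor mh
  field
    V : Subset n
    E : Subset n → Bool
    M : Subset n
open MH public

IsEdge : ∀ {n} → MH n → Subset n → Set
IsEdge H e = E H e ≡ true

IsMH : ∀ {n} → MH n → Set
IsMH H = Nonempty (V H)
       × (∀ e → IsEdge H e → Nonempty e × e ⊆ V H)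
       × M H ⊆ V H

Unmarked : ∀ {n} → MH n → Subset n
Unmarked H = V H ─ M H

-- H^{+x}: mark x (no effect if x ∉ V(H))
_⁺_ : ∀ {n} → MH n → Fin n → MH n
H ⁺ x = mh (V H) (E H) (M H ∪ (⁅ x ⁆ ∩ V H))

_⁻_ : ∀ {n} → MH n → Fin n → MH n
H ⁻ y = mh (V H ─ ⁅ y ⁆) (λ e → E H e ∧ not (lookup e y)) (M H ─ ⁅ y ⁆)

-- Maker win (inductive form of the recursive definition on |V \ M|)
data MakerWin {n : ℕ} : MH n → Set where
  base : ∀ {H} → ∣ Unmarked H ∣ ≤ 1 →
         (e : Subset n) → IsEdge H e → ∣ e ─ M H ∣ ≤ 1 → MakerWin H
  step : ∀ {H} → 2 ≤ ∣ Unmarked H ∣ →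
         (x : Fin n) → x ∈ Unmarked H →
         (∀ y → y ∈ Unmarked H → y ≢ x → MakerWin ((H ⁺ x) ⁻ y)) →
         MakerWin H

Sub : ∀ {n} → MH n → MH n → Set
Sub X H = IsMH X
        × V X ⊆ V H
        × (∀ e → IsEdge X e → IsEdge H e)
        × M X ≡ V X ∩ M H

image : ∀ {n m} → (Fin n → Fin m) → Subset n → Subset m
image {n} f e = ⋃ (map (λ v → if lookup e v then ⁅ f v ⁆ else ∅) (allFin n))

record PIso {n m : ℕ} (X : MH n) (x : Fin n) (D : MH m) (d : Fin m) : Set where
  field
    to      : Fin n → Fin m
    from    : Fin m → Fin n
    to-V    : ∀ v → v ∈ V X → to v ∈ V D
    from-V  : ∀ w → w ∈ V D → from w ∈ V X
    from-to : ∀ v → v ∈ V X → from (to v) ≡ v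
    to-from : ∀ w → w ∈ V D → to (from w) ≡ w
    marks   : ∀ v → v ∈ V X → (v ∈ M X ⇔ to v ∈ M D)
    edges   : ∀ e → e ⊆ V X → (IsEdge X e ⇔ IsEdge D (image to e))
    point   : to x ≡ d

Family : Set₁
Family = ∀ {m} → MH m → Fin m → Set

InFam : Family → ∀ {n} → MH n → Fin n → Set
InFam F X x = Σ ℕ λ m → Σ (MH m) λ D → Σ (Fin m) λ d → F D d × PIso X x D d

IsDangerFamily : Family → Set
IsDangerFamily F = ∀ {m} (D : MH m) (d : Fin m) → F D d →
  IsMH D × d ∈ Unmarked D × MakerWin (D ⁺ d)

xF : Family → ∀ {n} → Fin n → MH n → MH n → Set
xF F x H X = Sub X H × x ∈ V X × InFam F X x

Int : ∀ {n} → MH n → (MH n → Set) → Fin n → Set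
Int H 𝓧 v = v ∈ Unmarked H × (∀ X → 𝓧 X → v ∈ V X)

-- J_r(𝓕, H);  J 0 is unused (r ≥ 1)
J : ℕ → Family → ∀ {n} → MH n → Set
J zero F H = ⊤
J (suc zero) F H =
  ∀ x → x ∈ Unmarked H → ∃[ y ] Int (H ⁺ x) (xF F x H) y
J (suc (suc r)) F H =
  ∀ x → x ∈ Unmarked H → ∃[ y ] (Int (H ⁺ x) (xF F x H) y × J (suc r) F ((H ⁺ x) ⁻ y))

obs : Family → Family
obs F {m} D x =
  IsMH D × x ∈ Unmarked D ×
  Σ (Fin m) λ z → z ∈ Unmarked D × z ≢ x ×
  Σ (List (MH m)) λ 𝓞 →
    (∀ X → X ∈ₗ 𝓞 → Sub X D × z ∈ V X × InFam F (X ⁺ x) z)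
    × (∀ v → v ∈ V D → ∃[ X ] (X ∈ₗ 𝓞 × v ∈ V X))
    × (∀ e → IsEdge D e → ∃[ X ] (X ∈ₗ 𝓞 × IsEdge X e))
    × (∀ v → v ∈ M D → ∃[ X ] (X ∈ₗ 𝓞 × v ∈ M X))
    × (∀ v → ¬ Int ((D ⁺ x) ⁺ z) (_∈ₗ 𝓞) v)

star : ℕ → Family → Family
star zero F = F
star (suc r) F D x = F D x ⊎ obs (star r F) D x

{-# OPTIONS --safe #-}
module Submission where

-- By induction on r it suffices to show, for G ⊆ F ∪ obs G, that J_1(F ∪ obs G, H) holds iff
-- every unmarked x has a y ∈ Int(xF(H)) with J_1(G, H′), where H′ = H^{+x-y}.
-- If an obstruction D at x avoided such a y, its pieces pulled back into H′ would be
-- G-dangers at z, and the vertex that J_1(G, H′) provides for z would be an unmarked vertex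
-- common to all pieces, contradicting Int(𝒪) = ∅. Conversely, if J_1(G, H′) failed at x′,
-- excluded middle yields for every unmarked vertex a G-danger at x′ in H′ missing it. If one
-- of them contains x, their union with x unmarked is an obstruction at x avoiding y; if none
-- does, they are dangers at x′ in H itself and the answer to x′ in H lies in all of them.

open import Defs
open import Level using (0ℓ)
open import Axiom.ExcludedMiddle using (ExcludedMiddle)
open import Data.Nat using (ℕ; _≤_; _*_; _∸_)
open import Data.Fin.Subset using (∣_∣)
open import Function.Bundles using (_⇔_)

open import Data.Nat using (zero; suc; s≤s; z≤n; _+_)
open import Data.Nat.Properties using (≤-pred; ≤-trans; *-suc; *-monoʳ-≤; +-cancelˡ-≤)
open import Data.Bool using (Bool; true; false; _∧_; _∨_; not; if_then_else_)
open import Data.Bool.Properties using (∧-identityʳ; ∨-zeroʳ)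
open import Data.Fin using (Fin; zero; suc)
open import Data.Fin.Subset
  using (Subset; _∈_; _∉_; _⊆_; _∩_; _─_; _-_; ⁅_⁆; ⋃; Nonempty; inside; outside)
  renaming (⊥ to ∅)
open import Data.Fin.Subset.Properties
  using ( _∈?_; _⊆?_; nonempty?; Empty-unique; ∣⊥∣≡0; ∉⊥; x∈⁅x⁆; x∈⁅y⁆⇒x≡y; x∉⁅y⁆⇒x≢y
        ; ⊆-antisym; drop-there; p─⊥≡p; x∈p∩q⁺; x∈p∩q⁻; x∈p∪q⁺; x∈p∪q⁻; x∈p∧x≢y⇒x∈p-y; x∈p∧x∉q⇒x∈p─q)
open import Data.Vec using (_∷_; lookup; tabulate; here; there)
open import Data.Vec.Properties using ([]=⇒lookup; lookup⇒[]=; lookup∘tabulate)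
open import Data.List using (List; []; _∷_; allFin; map)
open import Data.List.Relation.Unary.Any using (here; there; any?)
open import Data.List.Membership.Propositional using (find; lose) renaming (_∈_ to _∈ₗ_)
open import Data.List.Membership.Propositional.Properties using (∈-allFin; ∈-map⁺; ∈-map⁻)
open import Data.Product using (Σ; _×_; _,_; proj₁; proj₂; ∃; ∃-syntax)
import Data.Product as Prod
open import Data.Sum using (_⊎_; inj₁; inj₂)
open import Data.Empty using (⊥; ⊥-elim)
open import Function.Base using (_∘_)
open import Function.Bundles using (mk⇔; Equivalence)
import Function.Properties.Equivalence as ⇔
open import Relation.Nullary using (¬_; Dec; yes; no; does; contradiction)
open import Relation.Nullary.Decidable using (dec-true)
open import Relation.Binary.PropositionalEquality
  using (_≡_; _≢_; refl; sym; trans; cong; cong₂; subst; subst₂; module ≡-Reasoning)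


private
  variable
    n m : ℕ

x∈p─q⁻ : ∀ {x : Fin n} (p q : Subset n) → x ∈ p ─ q → x ∈ p × x ∉ q
x∈p─q⁻ {x = zero}  (inside ∷ p) (outside ∷ q) here = here , λ ()
x∈p─q⁻ {x = suc x} (_ ∷ p)      (_ ∷ q)       (there x∈p─q) =
  Prod.map there (λ x∉q → x∉q ∘ drop-there) (x∈p─q⁻ p q x∈p─q)

x∈p-y⁻ : ∀ {x y : Fin n} (p : Subset n) → x ∈ p - y → x ∈ p × x ≢ y
x∈p-y⁻ p x∈p-y = Prod.map₂ x∉⁅y⁆⇒x≢y (x∈p─q⁻ p _ x∈p-y)

x∉p⇒lookup≡false : ∀ {x : Fin n} (p : Subset n) → x ∉ p → lookup p x ≡ false
x∉p⇒lookup≡false {x = x} p x∉p with lookup p x in eq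
... | false = refl
... | true  = contradiction (lookup⇒[]= x p eq) x∉p

∣p∣≡1+∣p-x∣ : ∀ {x : Fin n} (p : Subset n) → x ∈ p → ∣ p ∣ ≡ suc ∣ p - x ∣
∣p∣≡1+∣p-x∣ {x = zero}  (inside ∷ p)  here      = cong suc (sym (cong ∣_∣ (p─⊥≡p p)))
∣p∣≡1+∣p-x∣ {x = suc x} (inside ∷ p)  (there h) = cong suc (∣p∣≡1+∣p-x∣ p h)
∣p∣≡1+∣p-x∣ {x = suc x} (outside ∷ p) (there h) = ∣p∣≡1+∣p-x∣ p h

1≤∣p∣⇒Nonempty : ∀ {n} (p : Subset n) → 1 ≤ ∣ p ∣ → Nonempty p
1≤∣p∣⇒Nonempty {n} p 1≤∣p∣ with nonempty? p
... | yes ne = ne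
... | no ¬ne =
  contradiction (subst (1 ≤_) (∣⊥∣≡0 n) (subst (λ q → 1 ≤ ∣ q ∣) (Empty-unique ¬ne) 1≤∣p∣)) λ ()

2≤∣p∣⇒∃≢ : ∀ {x : Fin n} (p : Subset n) → x ∈ p → 2 ≤ ∣ p ∣ → ∃[ v ] (v ∈ p × v ≢ x)
2≤∣p∣⇒∃≢ p x∈p 2≤∣p∣ =
  let v , v∈p-x = 1≤∣p∣⇒Nonempty (p - _) (≤-pred (subst (2 ≤_) (∣p∣≡1+∣p-x∣ p x∈p) 2≤∣p∣))
  in  v , x∈p-y⁻ p v∈p-x

∈tabulate⁻ : ∀ (f : Fin n → Bool) {x} → x ∈ tabulate f → f x ≡ true
∈tabulate⁻ f {x} h = trans (sym (lookup∘tabulate f x)) ([]=⇒lookup h)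

∈tabulate⁺ : ∀ (f : Fin n → Bool) {x} → f x ≡ true → x ∈ tabulate f
∈tabulate⁺ f {x} fx = lookup⇒[]= x (tabulate f) (trans (lookup∘tabulate f x) fx)

∧≡true⁻ : ∀ {a b : Bool} → a ∧ b ≡ true → a ≡ true × b ≡ true
∧≡true⁻ {true} {true} _ = refl , refl

∨≡true⁻ : ∀ {a b : Bool} → a ∨ b ≡ true → a ≡ true ⊎ b ≡ true
∨≡true⁻ {true}  _   = inj₁ refl
∨≡true⁻ {false} b≡t = inj₂ b≡t

does≡true⇒ : ∀ {P : Set} (p? : Dec P) → does p? ≡ true → P
does≡true⇒ (yes p) _  = p
does≡true⇒ (no _)  ()

module _ {n m} (f : Fin n → Fin m) (e : Subset n) where

  private
    summand : Fin n → Subset m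
    summand v = if lookup e v then ⁅ f v ⁆ else ∅

  ∈image⁻ : ∀ {w} → w ∈ image f e → ∃[ v ] (v ∈ e × f v ≡ w)
  ∈image⁻ {w} = go (allFin n)
    where
    go : (vs : List (Fin n)) → w ∈ ⋃ (map summand vs) → ∃[ v ] (v ∈ e × f v ≡ w)
    go []       w∈ = contradiction w∈ ∉⊥
    go (v ∷ vs) w∈ with x∈p∪q⁻ (summand v) _ w∈
    ... | inj₂ w∈′ = go vs w∈′
    ... | inj₁ w∈′ with lookup e v in eq
    ...   | true  = v , lookup⇒[]= v e eq , sym (x∈⁅y⁆⇒x≡y _ w∈′)
    ...   | false = contradiction w∈′ ∉⊥

  ∈image⁺ : ∀ {v} → v ∈ e → f v ∈ image f e
  ∈image⁺ {v} v∈e = go (allFin n) (∈-allFin v)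
    where
    go : (vs : List (Fin n)) → v ∈ₗ vs → f v ∈ ⋃ (map summand vs)
    go (u ∷ vs) (here refl) rewrite []=⇒lookup v∈e = x∈p∪q⁺ (inj₁ (x∈⁅x⁆ (f v)))
    go (u ∷ vs) (there v∈vs) = x∈p∪q⁺ (inj₂ (go vs v∈vs))

image-id : (e : Subset n) → image (λ v → v) e ≡ e
image-id e = ⊆-antisym image⊆e (∈image⁺ (λ v → v) e)
  where
  image⊆e : image (λ v → v) e ⊆ e
  image⊆e w∈ with ∈image⁻ (λ v → v) e w∈
  ... | v , v∈e , refl = v∈e

image-∘ : ∀ {k} (f : Fin n → Fin m) (g : Fin m → Fin k) (e : Subset n) →
  image g (image f e) ≡ image (g ∘ f) e
image-∘ f g e = ⊆-antisym l r
  where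
  l : image g (image f e) ⊆ image (g ∘ f) e
  l w∈ with ∈image⁻ g (image f e) w∈
  ... | u , u∈ , refl with ∈image⁻ f e u∈
  ...   | v , v∈e , refl = ∈image⁺ (g ∘ f) e v∈e
  r : image (g ∘ f) e ⊆ image g (image f e)
  r w∈ with ∈image⁻ (g ∘ f) e w∈
  ... | v , v∈e , refl = ∈image⁺ g (image f e) (∈image⁺ f e v∈e)

image-⊆ : ∀ {A : Subset n} {B : Subset m} (f : Fin n → Fin m) →
  (∀ v → v ∈ A → f v ∈ B) → ∀ e → e ⊆ A → image f e ⊆ B
image-⊆ f f[A]⊆B e e⊆A w∈ with ∈image⁻ f e w∈
... | v , v∈e , refl = f[A]⊆B v (e⊆A v∈e)

∈Unmarked⁻ : (H : MH n) → ∀ {v} → v ∈ Unmarked H → v ∈ V H × v ∉ M H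
∈Unmarked⁻ H = x∈p─q⁻ (V H) (M H)

∈Unmarked⁺ : (H : MH n) → ∀ {v} → v ∈ V H → v ∉ M H → v ∈ Unmarked H
∈Unmarked⁺ H = x∈p∧x∉q⇒x∈p─q

∈M-mark⁻ : (H : MH n) → ∀ {a v} → v ∈ M (H ⁺ a) → v ∈ M H ⊎ (v ≡ a × v ∈ V H)
∈M-mark⁻ H v∈ with x∈p∪q⁻ (M H) _ v∈
... | inj₁ v∈M = inj₁ v∈M
... | inj₂ v∈a = inj₂ (Prod.map₁ (x∈⁅y⁆⇒x≡y _) (x∈p∩q⁻ _ _ v∈a))

∈M-mark⁺ : (H : MH n) → ∀ {a v} → v ∈ M H → v ∈ M (H ⁺ a)
∈M-mark⁺ H v∈M = x∈p∪q⁺ (inj₁ v∈M)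

a∈M-mark : (H : MH n) → ∀ {a} → a ∈ V H → a ∈ M (H ⁺ a)
a∈M-mark H {a} a∈V = x∈p∪q⁺ (inj₂ (x∈p∩q⁺ (x∈⁅x⁆ a , a∈V)))

Unmarked-mark : (H : MH n) (a : Fin n) → Unmarked (H ⁺ a) ≡ Unmarked H - a
Unmarked-mark H a = ⊆-antisym l r
  where
  l : Unmarked (H ⁺ a) ⊆ Unmarked H - a
  l v∈ = let v∈V , v∉M⁺ = ∈Unmarked⁻ (H ⁺ a) v∈ in
    x∈p∧x≢y⇒x∈p-y (∈Unmarked⁺ H v∈V (v∉M⁺ ∘ ∈M-mark⁺ H))
                  (λ { refl → v∉M⁺ (a∈M-mark H v∈V) })
  r : Unmarked H - a ⊆ Unmarked (H ⁺ a)
  r v∈ with x∈p-y⁻ (Unmarked H) v∈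
  ... | v∈U , v≢a with ∈Unmarked⁻ H v∈U
  ...   | v∈V , v∉M = ∈Unmarked⁺ (H ⁺ a) v∈V λ v∈M⁺ → case (∈M-mark⁻ H v∈M⁺)
    where
    case : _ → ⊥
    case (inj₁ v∈M)     = v∉M v∈M
    case (inj₂ (v≡a , _)) = v≢a v≡a

Unmarked-del : (H : MH n) (b : Fin n) → Unmarked (H ⁻ b) ≡ Unmarked H - b
Unmarked-del H b = ⊆-antisym l r
  where
  l : Unmarked (H ⁻ b) ⊆ Unmarked H - b
  l v∈ with ∈Unmarked⁻ (H ⁻ b) v∈
  ... | v∈V⁻ , v∉M⁻ with x∈p-y⁻ (V H) v∈V⁻
  ...   | v∈V , v≢b = x∈p∧x≢y⇒x∈p-y (∈Unmarked⁺ H v∈V (v∉M⁻ ∘ λ v∈M → x∈p∧x≢y⇒x∈p-y v∈M v≢b)) v≢b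
  r : Unmarked H - b ⊆ Unmarked (H ⁻ b)
  r v∈ with x∈p-y⁻ (Unmarked H) v∈
  ... | v∈U , v≢b with ∈Unmarked⁻ H v∈U
  ...   | v∈V , v∉M = ∈Unmarked⁺ (H ⁻ b) (x∈p∧x≢y⇒x∈p-y v∈V v≢b) (v∉M ∘ proj₁ ∘ x∈p-y⁻ (M H))

Unmarked-move : (H : MH n) (x y : Fin n) → Unmarked ((H ⁺ x) ⁻ y) ≡ Unmarked H - x - y
Unmarked-move H x y = trans (Unmarked-del (H ⁺ x) y) (cong (_- y) (Unmarked-mark H x))

∈Unmarked-mark⁻ : (H : MH n) → ∀ {a v} → v ∈ Unmarked (H ⁺ a) → v ∈ Unmarked H × v ≢ a
∈Unmarked-mark⁻ H {a} v∈ = x∈p-y⁻ (Unmarked H) (subst (_ ∈_) (Unmarked-mark H a) v∈)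

∈Unmarked-mark⁺ : (H : MH n) → ∀ {a v} → v ∈ Unmarked H → v ≢ a → v ∈ Unmarked (H ⁺ a)
∈Unmarked-mark⁺ H {a} v∈ v≢a = subst (_ ∈_) (sym (Unmarked-mark H a)) (x∈p∧x≢y⇒x∈p-y v∈ v≢a)

∈Unmarked-move⁻ : (H : MH n) → ∀ {x y v} → v ∈ Unmarked ((H ⁺ x) ⁻ y) →
  v ∈ Unmarked H × v ≢ x × v ≢ y
∈Unmarked-move⁻ H {x} {y} v∈ with x∈p-y⁻ (Unmarked H - x) (subst (_ ∈_) (Unmarked-move H x y) v∈)
... | v∈U-x , v≢y = Prod.map₂ (_, v≢y) (x∈p-y⁻ (Unmarked H) v∈U-x)

∈Unmarked-move⁺ : (H : MH n) → ∀ {x y v} → v ∈ Unmarked H → v ≢ x → v ≢ y →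
  v ∈ Unmarked ((H ⁺ x) ⁻ y)
∈Unmarked-move⁺ H {x} {y} v∈ v≢x v≢y =
  subst (_ ∈_) (sym (Unmarked-move H x y)) (x∈p∧x≢y⇒x∈p-y (x∈p∧x≢y⇒x∈p-y v∈ v≢x) v≢y)

∣Unmarked∣-move : (H : MH n) → ∀ {x y} → x ∈ Unmarked H → y ∈ Unmarked (H ⁺ x) →
  ∣ Unmarked H ∣ ≡ 2 + ∣ Unmarked ((H ⁺ x) ⁻ y) ∣
∣Unmarked∣-move H {x} {y} x∈U y∈U⁺ = begin
  ∣ Unmarked H ∣                 ≡⟨ ∣p∣≡1+∣p-x∣ (Unmarked H) x∈U ⟩
  suc ∣ Unmarked H - x ∣         ≡⟨ cong suc (∣p∣≡1+∣p-x∣ (Unmarked H - x) y∈U-x) ⟩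
  2 + ∣ Unmarked H - x - y ∣     ≡⟨ cong (λ p → 2 + ∣ p ∣) (sym (Unmarked-move H x y)) ⟩
  2 + ∣ Unmarked ((H ⁺ x) ⁻ y) ∣ ∎
  where
  open ≡-Reasoning
  y∈U-x = subst (y ∈_) (Unmarked-mark H x) y∈U⁺

IsEdge-del⁻ : (H : MH n) → ∀ {b e} → IsEdge (H ⁻ b) e → IsEdge H e × b ∉ e
IsEdge-del⁻ H {b} {e} e∈E⁻ with ∧≡true⁻ {E H e} e∈E⁻
... | e∈E , b∉e = e∈E , λ b∈e → contradiction (trans (cong not (sym ([]=⇒lookup b∈e))) b∉e) λ ()

IsEdge-del⁺ : (H : MH n) → ∀ {b e} → IsEdge H e → b ∉ e → IsEdge (H ⁻ b) e
IsEdge-del⁺ H {b} {e} e∈E b∉e = cong₂ (λ p q → p ∧ not q) e∈E (x∉p⇒lookup≡false e b∉e)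

M⊆V : {H : MH n} → IsMH H → M H ⊆ V H
M⊆V (_ , _ , M⊆V) = M⊆V

IsMH-mark : (H : MH n) → ∀ {a} → IsMH H → IsMH (H ⁺ a)
IsMH-mark H (nonempty , edges , M⊆V) = nonempty , edges , λ v∈M⁺ → case (∈M-mark⁻ H v∈M⁺)
  where
  case : ∀ {v a} → v ∈ M H ⊎ (v ≡ a × v ∈ V H) → v ∈ V H
  case (inj₁ v∈M)       = M⊆V v∈M
  case (inj₂ (_ , v∈V)) = v∈V

mkSub : {X H : MH n} → IsMH X → V X ⊆ V H → (∀ e → IsEdge X e → IsEdge H e) →
  M X ⊆ M H → (∀ {v} → v ∈ V X → v ∈ M H → v ∈ M X) → Sub X H
mkSub isX V⊆ E⊆ M⊆ M⊇ = isX , V⊆ , E⊆ , ⊆-antisym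
  (λ v∈M → x∈p∩q⁺ (M⊆V isX v∈M , M⊆ v∈M))
  (λ v∈ → let v∈V , v∈M = x∈p∩q⁻ _ _ v∈ in M⊇ v∈V v∈M)

module Sub {X H : MH n} (X⊑H : Sub X H) where

  isMH : IsMH X
  isMH = proj₁ X⊑H

  V⊆ : V X ⊆ V H
  V⊆ = proj₁ (proj₂ X⊑H)

  E⊆ : ∀ e → IsEdge X e → IsEdge H e
  E⊆ = proj₁ (proj₂ (proj₂ X⊑H))

  M⊆ : M X ⊆ M H
  M⊆ v∈M = proj₂ (x∈p∩q⁻ (V X) (M H) (subst (_ ∈_) (proj₂ (proj₂ (proj₂ X⊑H))) v∈M))

  M⊇ : ∀ {v} → v ∈ V X → v ∈ M H → v ∈ M X
  M⊇ v∈V v∈M = subst (_ ∈_) (sym (proj₂ (proj₂ (proj₂ X⊑H)))) (x∈p∩q⁺ (v∈V , v∈M))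

Sub-trans : {A X H : MH n} → Sub A X → Sub X H → Sub A H
Sub-trans A⊑X X⊑H = mkSub A.isMH (X.V⊆ ∘ A.V⊆) (λ e → X.E⊆ e ∘ A.E⊆ e) (X.M⊆ ∘ A.M⊆)
  (λ v∈V v∈M → A.M⊇ v∈V (X.M⊇ (A.V⊆ v∈V) v∈M))
  where
  module A = Sub A⊑X
  module X = Sub X⊑H

Sub-mark : {X H : MH n} → ∀ {a} → Sub X H → Sub (X ⁺ a) (H ⁺ a)
Sub-mark {X = X} {H} {a} X⊑H = mkSub (IsMH-mark X S.isMH) S.V⊆ S.E⊆ M⊆ M⊇
  where
  module S = Sub X⊑H
  M⊆ : M (X ⁺ a) ⊆ M (H ⁺ a)
  M⊆ v∈M with ∈M-mark⁻ X v∈M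
  ... | inj₁ v∈MX           = ∈M-mark⁺ H (S.M⊆ v∈MX)
  ... | inj₂ (refl , a∈VX)  = a∈M-mark H (S.V⊆ a∈VX)
  M⊇ : ∀ {v} → v ∈ V X → v ∈ M (H ⁺ a) → v ∈ M (X ⁺ a)
  M⊇ v∈V v∈M with ∈M-mark⁻ H v∈M
  ... | inj₁ v∈MH      = ∈M-mark⁺ X (S.M⊇ v∈V v∈MH)
  ... | inj₂ (refl , _) = a∈M-mark X v∈V

Sub-del : {X H : MH n} → ∀ {b} → Sub X H → b ∉ V X → Sub X (H ⁻ b)
Sub-del {X = X} {H} {b} X⊑H b∉V = mkSub S.isMH
  (λ v∈V → x∈p∧x≢y⇒x∈p-y (S.V⊆ v∈V) (≢b v∈V))
  (λ e e∈E → IsEdge-del⁺ H (S.E⊆ e e∈E) (b∉V ∘ proj₂ (proj₁ (proj₂ S.isMH) e e∈E)))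
  (λ v∈M → x∈p∧x≢y⇒x∈p-y (S.M⊆ v∈M) (≢b (M⊆V S.isMH v∈M)))
  (λ v∈V v∈M⁻ → S.M⊇ v∈V (proj₁ (x∈p-y⁻ (M H) v∈M⁻)))
  where
  module S = Sub X⊑H
  ≢b : ∀ {v} → v ∈ V X → v ≢ b
  ≢b v∈V refl = b∉V v∈V

Sub-undel : {X H : MH n} → ∀ {b} → Sub X (H ⁻ b) → Sub X H
Sub-undel {X = X} {H} {b} X⊑H⁻ = mkSub S.isMH
  (proj₁ ∘ x∈p-y⁻ (V H) ∘ S.V⊆)
  (λ e → proj₁ ∘ IsEdge-del⁻ H ∘ S.E⊆ e)
  (proj₁ ∘ x∈p-y⁻ (M H) ∘ S.M⊆)
  (λ v∈V v∈M → S.M⊇ v∈V (x∈p∧x≢y⇒x∈p-y v∈M (proj₂ (x∈p-y⁻ (V H) (S.V⊆ v∈V)))))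
  where
  module S = Sub X⊑H⁻

Sub-unmark : {X H : MH n} → ∀ {a} → Sub X (H ⁺ a) → a ∉ V X → Sub X H
Sub-unmark {X = X} {H} {a} X⊑H⁺ a∉V = mkSub S.isMH S.V⊆ S.E⊆ M⊆
  (λ v∈V v∈M → S.M⊇ v∈V (∈M-mark⁺ H v∈M))
  where
  module S = Sub X⊑H⁺
  M⊆ : M X ⊆ M H
  M⊆ v∈M with ∈M-mark⁻ H (S.M⊆ v∈M)
  ... | inj₁ v∈MH      = v∈MH
  ... | inj₂ (refl , _) = contradiction (M⊆V S.isMH v∈M) a∉V

inherit : MH n → MH n → MH n
inherit H X = mh (V X) (E X) (V X ∩ M H)

Sub-inherit : {X H : MH n} → ∀ {a} → Sub X (H ⁺ a) → Sub (inherit H X) H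
Sub-inherit {X = X} {H} X⊑H⁺ = mkSub isMH S.V⊆ S.E⊆ (proj₂ ∘ x∈p∩q⁻ _ _) (λ v∈V v∈M → x∈p∩q⁺ (v∈V , v∈M))
  where
  module S = Sub X⊑H⁺
  isMH : IsMH (inherit H X)
  isMH = proj₁ S.isMH , proj₁ (proj₂ S.isMH) , proj₁ ∘ x∈p∩q⁻ _ _

inherit-mark : {X H : MH n} → ∀ {a} → Sub X (H ⁺ a) → inherit H X ⁺ a ≡ X
inherit-mark {X = X} {H} {a} X⊑H⁺ = cong (mh (V X) (E X)) (⊆-antisym l r)
  where
  module S = Sub X⊑H⁺
  l : M (inherit H X ⁺ a) ⊆ M X
  l v∈M with ∈M-mark⁻ (inherit H X) v∈M
  ... | inj₁ v∈VM          = let v∈V , v∈MH = x∈p∩q⁻ _ _ v∈VM in S.M⊇ v∈V (∈M-mark⁺ H v∈MH)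
  ... | inj₂ (refl , a∈V) = S.M⊇ a∈V (a∈M-mark H (S.V⊆ a∈V))
  r : M X ⊆ M (inherit H X ⁺ a)
  r v∈M with ∈M-mark⁻ H (S.M⊆ v∈M)
  ... | inj₁ v∈MH      = ∈M-mark⁺ (inherit H X) (x∈p∩q⁺ (M⊆V S.isMH v∈M , v∈MH))
  ... | inj₂ (refl , _) = a∈M-mark (inherit H X) (M⊆V S.isMH v∈M)

PIso-refl : (X : MH n) (x : Fin n) → PIso X x X x
PIso-refl X x = record
  { to = λ v → v ; from = λ v → v
  ; to-V = λ _ v∈V → v∈V ; from-V = λ _ v∈V → v∈V
  ; from-to = λ _ _ → refl ; to-from = λ _ _ → refl
  ; marks = λ _ _ → ⇔.refl
  ; edges = λ e _ → mk⇔ (subst (IsEdge X) (sym (image-id e))) (subst (IsEdge X) (image-id e))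
  ; point = refl }

PIso-trans : {A : MH n} {a : Fin n} {B : MH m} {b : Fin m} {k : ℕ} {C : MH k} {c : Fin k} →
  PIso A a B b → PIso B b C c → PIso A a C c
PIso-trans {C = C} i j = record
  { to = J.to ∘ I.to ; from = I.from ∘ J.from
  ; to-V = λ v v∈A → J.to-V _ (I.to-V v v∈A)
  ; from-V = λ w w∈C → I.from-V _ (J.from-V w w∈C)
  ; from-to = λ v v∈A → trans (cong I.from (J.from-to _ (I.to-V v v∈A))) (I.from-to v v∈A)
  ; to-from = λ w w∈C → trans (cong J.to (I.to-from _ (J.from-V w w∈C))) (J.to-from w w∈C)
  ; marks = λ v v∈A → ⇔.trans (I.marks v v∈A) (J.marks _ (I.to-V v v∈A))
  ; edges = λ e e⊆A → ⇔.trans (I.edges e e⊆A)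
      (⇔.trans (J.edges _ (image-⊆ I.to I.to-V e e⊆A))
               (mk⇔ (subst (IsEdge C) (image-∘ I.to J.to e)) (subst (IsEdge C) (sym (image-∘ I.to J.to e)))))
  ; point = trans (cong J.to I.point) J.point }
  where
  module I = PIso i
  module J = PIso j

PIso-injective : {A : MH n} {a : Fin n} {B : MH m} {b : Fin m} (i : PIso A a B b) →
  ∀ {v w} → v ∈ V A → w ∈ V A → PIso.to i v ≡ PIso.to i w → v ≡ w
PIso-injective i {v} {w} v∈A w∈A tv≡tw =
  trans (sym (from-to v v∈A)) (trans (cong from tv≡tw) (from-to w w∈A))
  where open PIso i

PIso-mark : {A : MH n} {a : Fin n} {B : MH m} {b : Fin m} (i : PIso A a B b) →
  ∀ {a′ b′} → (∀ u → u ∈ V A → u ≡ a′ ⇔ PIso.to i u ≡ b′) → PIso (A ⁺ a′) a (B ⁺ b′) b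
PIso-mark {A = A} {B = B} i {a′} {b′} a′↦b′ = record
  { to = to ; from = from ; to-V = to-V ; from-V = from-V
  ; from-to = from-to ; to-from = to-from
  ; marks = λ u u∈A → mk⇔ (marks⁺ u u∈A) (marks⁻ u u∈A)
  ; edges = edges ; point = point }
  where
  open PIso i
  marks⁺ : ∀ u → u ∈ V A → u ∈ M (A ⁺ a′) → to u ∈ M (B ⁺ b′)
  marks⁺ u u∈A u∈M with ∈M-mark⁻ A u∈M
  ... | inj₁ u∈MA = ∈M-mark⁺ B (Equivalence.to (marks u u∈A) u∈MA)
  ... | inj₂ (u≡a′ , _) with Equivalence.to (a′↦b′ u u∈A) u≡a′
  ...   | tu≡b′ = subst (_∈ M (B ⁺ b′)) (sym tu≡b′) (a∈M-mark B (subst (_∈ V B) tu≡b′ (to-V u u∈A)))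
  marks⁻ : ∀ u → u ∈ V A → to u ∈ M (B ⁺ b′) → u ∈ M (A ⁺ a′)
  marks⁻ u u∈A tu∈M with ∈M-mark⁻ B tu∈M
  ... | inj₁ tu∈MB = ∈M-mark⁺ A (Equivalence.from (marks u u∈A) tu∈MB)
  ... | inj₂ (tu≡b′ , _) with Equivalence.from (a′↦b′ u u∈A) tu≡b′
  ...   | refl = a∈M-mark A u∈A

_⊆ᶠ_ : Family → Family → Set
F ⊆ᶠ G = ∀ {m} (D : MH m) d → F D d → G D d

_⊎obs_ : Family → Family → Family
(F ⊎obs G) D d = F D d ⊎ obs G D d

InFam-mono : {F G : Family} → F ⊆ᶠ G → ∀ {n} {X : MH n} {x} → InFam F X x → InFam G X x
InFam-mono F⊆G (m , D , d , D∈F , i) = m , D , d , F⊆G D d D∈F , i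

obs-mono : {F G : Family} → F ⊆ᶠ G → obs F ⊆ᶠ obs G
obs-mono {F} {G} F⊆G D x (isD , x∈U , z , z∈U , z≢x , O , members , covers) =
  isD , x∈U , z , z∈U , z≢x , O ,
  (λ X X∈O → Prod.map₂ (Prod.map₂ (InFam-mono {F} {G} F⊆G)) (members X X∈O)) , covers

star-⊆ᶠ-suc : (F : Family) (k : ℕ) → star k F ⊆ᶠ star (suc k) F
star-⊆ᶠ-suc F zero    D x D∈F         = inj₁ D∈F
star-⊆ᶠ-suc F (suc k) D x (inj₁ D∈F)  = inj₁ D∈F
star-⊆ᶠ-suc F (suc k) D x (inj₂ D∈obs) =
  inj₂ (obs-mono {star k F} {star (suc k) F} (star-⊆ᶠ-suc F k) D x D∈obs)

module Pullback {X : MH n} {x : Fin n} {D : MH m} {d : Fin m} (i : PIso X x D d) where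
  open PIso i

  Vpullback : MH m → Subset n
  Vpullback Y = tabulate (λ v → does (v ∈? V X) ∧ does (to v ∈? V Y))

  pullback : MH m → MH n
  pullback Y = mh (Vpullback Y) (λ e → E Y (image to e) ∧ does (e ⊆? Vpullback Y)) (Vpullback Y ∩ M X)

  ∈V-pullback⁻ : ∀ Y {v} → v ∈ V (pullback Y) → v ∈ V X × to v ∈ V Y
  ∈V-pullback⁻ Y {v} v∈ =
    Prod.map (does≡true⇒ (v ∈? V X)) (does≡true⇒ (to v ∈? V Y)) (∧≡true⁻ (∈tabulate⁻ _ v∈))

  ∈V-pullback⁺ : ∀ Y {v} → v ∈ V X → to v ∈ V Y → v ∈ V (pullback Y)
  ∈V-pullback⁺ Y {v} v∈X tv∈Y =
    ∈tabulate⁺ _ (cong₂ _∧_ (dec-true (v ∈? V X) v∈X) (dec-true (to v ∈? V Y) tv∈Y))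

  IsEdge-pullback : ∀ Y e → e ⊆ V (pullback Y) → IsEdge (pullback Y) e ⇔ IsEdge Y (image to e)
  IsEdge-pullback Y e e⊆ with e ⊆? Vpullback Y
  ... | yes _  = mk⇔ (trans (sym (∧-identityʳ _))) (trans (∧-identityʳ _))
  ... | no e⊈ = ⊥-elim (e⊈ e⊆)

  IsEdge-pullback-⊆ : ∀ Y e → IsEdge (pullback Y) e → e ⊆ V (pullback Y)
  IsEdge-pullback-⊆ Y e e∈E = does≡true⇒ (e ⊆? Vpullback Y) (proj₂ (∧≡true⁻ {E Y (image to e)} e∈E))

  pullback-Sub : ∀ {Y} → Sub Y D → Sub (pullback Y) X
  pullback-Sub {Y} Y⊑D = mkSub (nonempty , wf-edges , proj₁ ∘ x∈p∩q⁻ _ _)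
    (proj₁ ∘ ∈V-pullback⁻ Y) E⊆ (proj₂ ∘ x∈p∩q⁻ _ _) (λ v∈V v∈M → x∈p∩q⁺ (v∈V , v∈M))
    where
    module S = Sub Y⊑D
    nonempty : Nonempty (V (pullback Y))
    nonempty with proj₁ S.isMH
    ... | w , w∈Y = from w , ∈V-pullback⁺ Y (from-V w (S.V⊆ w∈Y))
                                 (subst (_∈ V Y) (sym (to-from w (S.V⊆ w∈Y))) w∈Y)
    wf-edges : ∀ e → IsEdge (pullback Y) e → Nonempty e × e ⊆ V (pullback Y)
    wf-edges e e∈E =
      let e⊆ = IsEdge-pullback-⊆ Y e e∈E
          w , w∈image = proj₁ (proj₁ (proj₂ S.isMH) (image to e) (Equivalence.to (IsEdge-pullback Y e e⊆) e∈E))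
          v , v∈e , _ = ∈image⁻ to e w∈image
      in (v , v∈e) , e⊆
    E⊆ : ∀ e → IsEdge (pullback Y) e → IsEdge X e
    E⊆ e e∈E = Equivalence.from (edges e (proj₁ ∘ ∈V-pullback⁻ Y ∘ e⊆))
                 (S.E⊆ _ (Equivalence.to (IsEdge-pullback Y e e⊆) e∈E))
      where e⊆ = IsEdge-pullback-⊆ Y e e∈E

  pullback-PIso : ∀ {Y w} → Sub Y D → w ∈ V Y → PIso (pullback Y) (from w) Y w
  pullback-PIso {Y} {w} Y⊑D w∈Y = record
    { to = to ; from = from
    ; to-V = λ _ → proj₂ ∘ ∈V-pullback⁻ Y
    ; from-V = λ u u∈Y → ∈V-pullback⁺ Y (from-V u (S.V⊆ u∈Y))
                           (subst (_∈ V Y) (sym (to-from u (S.V⊆ u∈Y))) u∈Y)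
    ; from-to = λ v → from-to v ∘ proj₁ ∘ ∈V-pullback⁻ Y
    ; to-from = λ u → to-from u ∘ S.V⊆
    ; marks = λ v v∈ → mk⇔ (marks⁺ v∈) (marks⁻ v∈)
    ; edges = IsEdge-pullback Y
    ; point = to-from w (S.V⊆ w∈Y) }
    where
    module S = Sub Y⊑D
    marks⁺ : ∀ {v} → v ∈ V (pullback Y) → v ∈ M (pullback Y) → to v ∈ M Y
    marks⁺ {v} v∈ v∈M = let v∈X , tv∈Y = ∈V-pullback⁻ Y v∈ in
      S.M⊇ tv∈Y (Equivalence.to (marks v v∈X) (proj₂ (x∈p∩q⁻ _ _ v∈M)))
    marks⁻ : ∀ {v} → v ∈ V (pullback Y) → to v ∈ M Y → v ∈ M (pullback Y)
    marks⁻ {v} v∈ tv∈M = x∈p∩q⁺ (v∈ , Equivalence.from (marks v (proj₁ (∈V-pullback⁻ Y v∈))) (S.M⊆ tv∈M))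

J₁-move⇒obs∋y : (G : Family) (H : MH n) → ∀ {x y} → J 1 G ((H ⁺ x) ⁻ y) →
  ∀ {X} → xF (obs G) x H X → y ∈ V X
J₁-move⇒obs∋y G H {x} {y} J₁G {X}
  (X⊑H , x∈X , _ , D , d , (_ , d∈U , z , z∈U , z≢d , O , members , covV , _ , _ , noInt) , i)
  with y ∈? V X
... | yes y∈X = y∈X
... | no  y∉X = ⊥-elim (noInt (to y′) (ty′∈U , λ Y Y∈O → proj₂ (∈V-pullback⁻ Y (y′∈pullback Y∈O))))
  where
  open PIso i
  open Pullback i
  module X = Sub X⊑H
  H′ = (H ⁺ x) ⁻ y
  d∈D = proj₁ (∈Unmarked⁻ D d∈U)
  z∈D = proj₁ (∈Unmarked⁻ D z∈U)
  z′ = from z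
  z′∈X = from-V z z∈D
  tz′≡z = to-from z z∈D

  injective : ∀ {v w} → v ∈ V X → w ∈ V X → to v ≡ to w → v ≡ w
  injective = PIso-injective i

  piece : ∀ {Y} → Y ∈ₗ O → xF G z′ H′ (pullback Y ⁺ x)
  piece {Y} Y∈O =
    let Y⊑D , z∈Y , (_ , C , c , C∈G , j) = members Y Y∈O
        x↦d : ∀ u → u ∈ V (pullback Y) → u ≡ x ⇔ to u ≡ d
        x↦d u u∈ = mk⇔ (λ { refl → point })
                        (λ tu≡d → injective (proj₁ (∈V-pullback⁻ Y u∈)) x∈X (trans tu≡d (sym point)))
    in Sub-del (Sub-mark (Sub-trans (pullback-Sub Y⊑D) X⊑H)) (y∉X ∘ proj₁ ∘ ∈V-pullback⁻ Y) ,
       ∈V-pullback⁺ Y z′∈X (subst (_∈ V Y) (sym tz′≡z) z∈Y) ,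
       _ , C , c , C∈G , PIso-trans (PIso-mark (pullback-PIso Y⊑D z∈Y) x↦d) j

  z′∈U′ : z′ ∈ Unmarked H′
  z′∈U′ = ∈Unmarked-move⁺ H (∈Unmarked⁺ H (X.V⊆ z′∈X) z′∉M)
    (λ z′≡x → z≢d (trans (sym tz′≡z) (trans (cong to z′≡x) point)))
    (λ { refl → y∉X z′∈X })
    where
    z′∉M : z′ ∉ M H
    z′∉M z′∈M = proj₂ (∈Unmarked⁻ D z∈U)
      (subst (_∈ M D) tz′≡z (Equivalence.to (marks z′ z′∈X) (X.M⊇ z′∈X z′∈M)))

  y′ = proj₁ (J₁G z′ z′∈U′)
  y′∈U″ = proj₁ (proj₂ (J₁G z′ z′∈U′))

  y′∈pullback : ∀ {Y} → Y ∈ₗ O → y′ ∈ V (pullback Y)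
  y′∈pullback Y∈O = proj₂ (proj₂ (J₁G z′ z′∈U′)) _ (piece Y∈O)

  y′∈X : y′ ∈ V X
  y′∈X = let Y , Y∈O , _ = covV d d∈D in proj₁ (∈V-pullback⁻ Y (y′∈pullback Y∈O))

  ty′∈U : to y′ ∈ Unmarked ((D ⁺ d) ⁺ z)
  ty′∈U =
    let y′∈U′ , y′≢z′ = ∈Unmarked-mark⁻ H′ y′∈U″
        y′∈U , y′≢x , _ = ∈Unmarked-move⁻ H y′∈U′
        ty′∉M : to y′ ∉ M D
        ty′∉M ty′∈M = proj₂ (∈Unmarked⁻ H y′∈U) (X.M⊆ (Equivalence.from (marks y′ y′∈X) ty′∈M))
    in ∈Unmarked-mark⁺ (D ⁺ d)
         (∈Unmarked-mark⁺ D (∈Unmarked⁺ D (to-V y′ y′∈X) ty′∉M)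
                            (λ ty′≡d → y′≢x (injective y′∈X x∈X (trans ty′≡d (sym point)))))
         (λ ty′≡z → y′≢z′ (injective y′∈X z′∈X (trans ty′≡z (sym tz′≡z))))

anyEdge : List (MH n) → Subset n → Bool
anyEdge []      e = false
anyEdge (X ∷ O) e = E X e ∨ anyEdge O e

glue : MH n → List (MH n) → MH n
glue H O = mh (⋃ (map V O)) (anyEdge O) (⋃ (map V O) ∩ M H)

∈⋃V⁻ : ∀ (O : List (MH n)) {v} → v ∈ ⋃ (map V O) → ∃[ X ] (X ∈ₗ O × v ∈ V X)
∈⋃V⁻ []      v∈ = contradiction v∈ ∉⊥
∈⋃V⁻ (X ∷ O) v∈ with x∈p∪q⁻ (V X) _ v∈
... | inj₁ v∈X = X , here refl , v∈X
... | inj₂ v∈O = Prod.map₂ (Prod.map₁ there) (∈⋃V⁻ O v∈O)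

∈⋃V⁺ : ∀ {O : List (MH n)} {X v} → X ∈ₗ O → v ∈ V X → v ∈ ⋃ (map V O)
∈⋃V⁺ (here refl)  v∈X = x∈p∪q⁺ (inj₁ v∈X)
∈⋃V⁺ (there X∈O) v∈X = x∈p∪q⁺ (inj₂ (∈⋃V⁺ X∈O v∈X))

anyEdge⁻ : ∀ (O : List (MH n)) {e} → anyEdge O e ≡ true → ∃[ X ] (X ∈ₗ O × IsEdge X e)
anyEdge⁻ (X ∷ O) {e} e∈E with ∨≡true⁻ {E X e} e∈E
... | inj₁ e∈X = X , here refl , e∈X
... | inj₂ e∈O = Prod.map₂ (Prod.map₁ there) (anyEdge⁻ O e∈O)

anyEdge⁺ : ∀ {O : List (MH n)} {X e} → X ∈ₗ O → IsEdge X e → anyEdge O e ≡ true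
anyEdge⁺ {e = e} (here refl) e∈X rewrite e∈X = refl
anyEdge⁺ {O = Y ∷ O} {e = e} (there X∈O) e∈X
  rewrite anyEdge⁺ {O = O} X∈O e∈X = ∨-zeroʳ (E Y e)

module _ {H : MH n} where

  module _ {O : List (MH n)} (O⊑H : ∀ X → X ∈ₗ O → Sub X H) where

    Sub-glue : ∀ {X} → X ∈ₗ O → Sub X (glue H O)
    Sub-glue {X} X∈O = mkSub S.isMH (∈⋃V⁺ X∈O) (λ e → anyEdge⁺ X∈O)
      (λ v∈M → x∈p∩q⁺ (∈⋃V⁺ X∈O (M⊆V S.isMH v∈M) , S.M⊆ v∈M))
      (λ v∈V v∈M → S.M⊇ v∈V (proj₂ (x∈p∩q⁻ _ _ v∈M)))
      where module S = Sub (O⊑H X X∈O)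

    glue-Sub : ∀ {X} → X ∈ₗ O → Nonempty (V X) → Sub (glue H O) H
    glue-Sub X∈O (v , v∈X) = mkSub
      ((v , ∈⋃V⁺ X∈O v∈X) , wf-edges , proj₁ ∘ x∈p∩q⁻ _ _)
      V⊆ E⊆ (proj₂ ∘ x∈p∩q⁻ _ _) (λ v∈V v∈M → x∈p∩q⁺ (v∈V , v∈M))
      where
      V⊆ : V (glue H O) ⊆ V H
      V⊆ v∈ = let X , X∈O , v∈X = ∈⋃V⁻ O v∈ in Sub.V⊆ (O⊑H X X∈O) v∈X
      E⊆ : ∀ e → IsEdge (glue H O) e → IsEdge H e
      E⊆ e e∈E = let X , X∈O , e∈X = anyEdge⁻ O e∈E in Sub.E⊆ (O⊑H X X∈O) e e∈X
      wf-edges : ∀ e → IsEdge (glue H O) e → Nonempty e × e ⊆ V (glue H O)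
      wf-edges e e∈E = let X , X∈O , e∈X = anyEdge⁻ O e∈E in
        Prod.map₂ (λ e⊆X w∈e → ∈⋃V⁺ X∈O (e⊆X w∈e)) (proj₁ (proj₂ (Sub.isMH (O⊑H X X∈O))) e e∈X)

    ∈M-glue⁻ : ∀ {v} → v ∈ M (glue H O) → ∃[ X ] (X ∈ₗ O × v ∈ M X)
    ∈M-glue⁻ v∈M = let v∈V , v∈MH = x∈p∩q⁻ _ _ v∈M
                       X , X∈O , v∈X = ∈⋃V⁻ O v∈V
                   in X , X∈O , Sub.M⊇ (O⊑H X X∈O) v∈X v∈MH

finite-choice : {A : Set} (U : Subset n) (R : Fin n → A → Set) → (∀ v → v ∈ U → ∃ (R v)) →
  Σ (List A) λ O → (∀ X → X ∈ₗ O → ∃[ v ] R v X) × (∀ v → v ∈ U → ∃[ X ] (X ∈ₗ O × R v X))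
finite-choice {n} {A} U R choice =
  Prod.map₂ (Prod.map₂ (λ complete v → complete v (∈-allFin v))) (go (allFin n))
  where
  go : (vs : List (Fin n)) → Σ (List A) λ O →
       (∀ X → X ∈ₗ O → ∃[ v ] R v X) × (∀ v → v ∈ₗ vs → v ∈ U → ∃[ X ] (X ∈ₗ O × R v X))
  go [] = [] , (λ _ ()) , (λ _ ())
  go (v ∷ vs) with go vs | v ∈? U
  ... | O , sound , complete | no v∉U =
    O , sound , λ { w (here refl) w∈U → contradiction w∈U v∉U ; w (there w∈vs) → complete w w∈vs }
  ... | O , sound , complete | yes v∈U with choice v v∈U
  ...   | X , Rv = X ∷ O
      , (λ { _ (here refl) → v , Rv ; Y (there Y∈O) → sound Y Y∈O })
      , (λ { _ (here refl) _ → X , here refl , Rv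
           ; w (there w∈vs) w∈U → Prod.map₂ (Prod.map₁ there) (complete w w∈vs w∈U) })

¬Int⇒missing : ExcludedMiddle 0ℓ → (K : MH n) (P : MH n → Set) → ¬ (∃[ v ] Int K P v) →
  ∀ v → v ∈ Unmarked K → ∃[ X ] (P X × v ∉ V X)
¬Int⇒missing em K P ¬Int v v∈U with em {∃[ X ] (P X × v ∉ V X)}
... | yes missed = missed
... | no ¬missed = contradiction (v , v∈U , in-all) ¬Int
  where
  in-all : ∀ X → P X → v ∈ V X
  in-all X PX with v ∈? V X
  ... | yes v∈X = v∈X
  ... | no  v∉X = contradiction (X , PX , v∉X) ¬missed

module Backward (em : ExcludedMiddle 0ℓ) (F G : Family) (G⊆ : G ⊆ᶠ (F ⊎obs G)) (H : MH n)
  (J₁ : J 1 (F ⊎obs G) H) {x : Fin n} (x∈U : x ∈ Unmarked H) where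

  y : Fin n
  y = proj₁ (J₁ x x∈U)

  y∈U⁺ : y ∈ Unmarked (H ⁺ x)
  y∈U⁺ = proj₁ (proj₂ (J₁ x x∈U))

  y∈all : ∀ X → xF (F ⊎obs G) x H X → y ∈ V X
  y∈all = proj₂ (proj₂ (J₁ x x∈U))

  H′ : MH n
  H′ = (H ⁺ x) ⁻ y

  ≢y : ∀ {X v} → Sub X H′ → v ∈ V X → v ≢ y
  ≢y X⊑H′ v∈X = proj₂ (x∈p-y⁻ (V H) (Sub.V⊆ X⊑H′ v∈X))

  module _ {x′} (x′∈U′ : x′ ∈ Unmarked H′) {O : List (MH n)}
           (chosen : ∀ X → X ∈ₗ O → ∃[ v ] (xF G x′ H′ X × v ∉ V X))
           (covering : ∀ v → v ∈ Unmarked (H′ ⁺ x′) → ∃[ X ] (X ∈ₗ O × xF G x′ H′ X × v ∉ V X)) where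

    sound : ∀ X → X ∈ₗ O → xF G x′ H′ X
    sound X = proj₁ ∘ proj₂ ∘ chosen X

    complete : ∀ v → v ∈ Unmarked (H′ ⁺ x′) → ∃[ X ] (X ∈ₗ O × v ∉ V X)
    complete v = Prod.map₂ (Prod.map₂ proj₂) ∘ covering v

    x′∈U : x′ ∈ Unmarked H
    x′∈U = proj₁ (∈Unmarked-move⁻ H x′∈U′)

    O⊑H′ : ∀ X → X ∈ₗ O → Sub X H′
    O⊑H′ X = proj₁ ∘ sound X

    avoiding-x-absurd : ∀ {X₀} → X₀ ∈ₗ O → (∀ X → X ∈ₗ O → x ∉ V X) → ⊥
    avoiding-x-absurd {X₀} X₀∈O x∉O = let X , X∈O , y″∉X = complete y″ y″∈U′⁺ in y″∉X (y″∈all X X∈O)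
      where
      lift : ∀ X → X ∈ₗ O → xF (F ⊎obs G) x′ H X
      lift X X∈O = let X⊑H′ , x′∈X , inG = sound X X∈O in
        Sub-unmark (Sub-undel X⊑H′) (x∉O X X∈O) , x′∈X , InFam-mono {G} {F ⊎obs G} G⊆ inG
      y″ = proj₁ (J₁ x′ x′∈U)
      y″∈all : ∀ X → X ∈ₗ O → y″ ∈ V X
      y″∈all X X∈O = proj₂ (proj₂ (J₁ x′ x′∈U)) X (lift X X∈O)
      y″∈U′⁺ : y″ ∈ Unmarked (H′ ⁺ x′)
      y″∈U′⁺ = let y″∈U , y″≢x′ = ∈Unmarked-mark⁻ H (proj₁ (proj₂ (J₁ x′ x′∈U)))
                   y″∈X₀ = y″∈all X₀ X₀∈O
               in ∈Unmarked-mark⁺ H′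
                    (∈Unmarked-move⁺ H y″∈U (λ y″≡x → x∉O X₀ X₀∈O (subst (_∈ V X₀) y″≡x y″∈X₀))
                                            (≢y (O⊑H′ X₀ X₀∈O) y″∈X₀))
                    y″≢x′

    O* : List (MH n)
    O* = map (inherit H) O

    O*⊑H : ∀ Z → Z ∈ₗ O* → Sub Z H
    O*⊑H Z Z∈O* with ∈-map⁻ (inherit H) Z∈O*
    ... | X , X∈O , refl = Sub-inherit (Sub-undel (O⊑H′ X X∈O))

    containing-x-absurd : ∀ {X₁} → X₁ ∈ₗ O → x ∈ V X₁ → ⊥
    containing-x-absurd {X₁} X₁∈O x∈X₁ = y∉D (y∈all D (D⊑H , x∈D , _ , D , x , inj₂ D∈obs , PIso-refl D x))
      where
      D = glue H O*
      X₁*∈O* = ∈-map⁺ (inherit H) X₁∈O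
      D⊑H = glue-Sub O*⊑H X₁*∈O* (_ , x∈X₁)
      x∈D = ∈⋃V⁺ X₁*∈O* x∈X₁

      ∈U-D : ∀ {v} → v ∈ V X₁ → v ∈ Unmarked H → v ∈ Unmarked D
      ∈U-D v∈X₁ v∈U = ∈Unmarked⁺ D (∈⋃V⁺ X₁*∈O* v∈X₁) (proj₂ (∈Unmarked⁻ H v∈U) ∘ Sub.M⊆ D⊑H)

      y∉D : y ∉ V D
      y∉D y∈D = let Z , Z∈O* , y∈Z = ∈⋃V⁻ O* y∈D
                    X , X∈O , Z≡X* = ∈-map⁻ (inherit H) Z∈O*
                in ≢y (O⊑H′ X X∈O) (subst (λ W → y ∈ V W) Z≡X* y∈Z) refl

      members : ∀ Z → Z ∈ₗ O* → Sub Z D × x′ ∈ V Z × InFam G (Z ⁺ x) x′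
      members Z Z∈O* with ∈-map⁻ (inherit H) Z∈O*
      ... | X , X∈O , refl = let _ , x′∈X , inG = sound X X∈O in
        Sub-glue O*⊑H Z∈O* , x′∈X ,
        subst (λ W → InFam G W x′) (sym (inherit-mark (Sub-undel (O⊑H′ X X∈O)))) inG

      no-Int : ∀ v → ¬ Int ((D ⁺ x) ⁺ x′) (_∈ₗ O*) v
      no-Int v (v∈U″ , v∈all) =
        let X , X∈O , v∉X = complete v v∈U′⁺ in v∉X (v∈all (inherit H X) (∈-map⁺ (inherit H) X∈O))
        where
        v∈U′⁺ : v ∈ Unmarked (H′ ⁺ x′)
        v∈U′⁺ = let v∈U⁺ , v≢x′ = ∈Unmarked-mark⁻ (D ⁺ x) v∈U″
                    v∈UD , v≢x = ∈Unmarked-mark⁻ D v∈U⁺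
                    v∈VD , v∉MD = ∈Unmarked⁻ D v∈UD
                    v∈U = ∈Unmarked⁺ H (Sub.V⊆ D⊑H v∈VD) (v∉MD ∘ Sub.M⊇ D⊑H v∈VD)
                    v≢y = λ v≡y → y∉D (subst (_∈ V D) v≡y v∈VD)
                in ∈Unmarked-mark⁺ H′ (∈Unmarked-move⁺ H v∈U v≢x v≢y) v≢x′

      D∈obs : obs G D x
      D∈obs = Sub.isMH D⊑H , ∈U-D x∈X₁ x∈U ,
              x′ , ∈U-D (proj₁ (proj₂ (sound X₁ X₁∈O))) x′∈U , proj₁ (proj₂ (∈Unmarked-move⁻ H x′∈U′)) ,
              O* , members ,
              (λ v → ∈⋃V⁻ O*) , (λ e → anyEdge⁻ O*) , (λ v → ∈M-glue⁻ O*⊑H) , no-Int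

    covering-absurd : 2 ≤ ∣ Unmarked H′ ∣ → ⊥
    covering-absurd 2≤∣U′∣ with any? (λ X → x ∈? V X) O
    ... | yes x∈some = let X₁ , X₁∈O , x∈X₁ = find x∈some in containing-x-absurd X₁∈O x∈X₁
    ... | no  x∉all  = avoiding-x-absurd X₀∈O λ X X∈O x∈X → x∉all (lose X∈O x∈X)
      where
      X₀∈O = let v₀ , v₀∈U′ , v₀≢x′ = 2≤∣p∣⇒∃≢ (Unmarked H′) x′∈U′ 2≤∣U′∣
             in proj₁ (proj₂ (complete v₀ (∈Unmarked-mark⁺ H′ v₀∈U′ v₀≢x′)))

  J₁-move : 2 ≤ ∣ Unmarked H′ ∣ → J 1 G H′
  J₁-move 2≤∣U′∣ x′ x′∈U′ with em {∃[ v ] Int (H′ ⁺ x′) (xF G x′ H′) v}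
  ... | yes found  = found
  ... | no ¬found  =
    let O , chosen , covering = finite-choice (Unmarked (H′ ⁺ x′)) (λ v X → xF G x′ H′ X × v ∉ V X)
                                  (¬Int⇒missing em (H′ ⁺ x′) (xF G x′ H′) ¬found)
    in ⊥-elim (covering-absurd x′∈U′ chosen covering 2≤∣U′∣)

-- J (suc (suc r)) F H unfolds to JStep F (J (suc r) F) H.
JStep : Family → (MH n → Set) → MH n → Set
JStep F P H = ∀ x → x ∈ Unmarked H → ∃[ y ] (Int (H ⁺ x) (xF F x H) y × P ((H ⁺ x) ⁻ y))

JStep-map : {F : Family} {P Q : MH n → Set} (H : MH n) →
  (∀ {x y} → x ∈ Unmarked H → y ∈ Unmarked (H ⁺ x) → P ((H ⁺ x) ⁻ y) → Q ((H ⁺ x) ⁻ y)) →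
  JStep F P H → JStep F Q H
JStep-map H P⇒Q next x x∈U = let y , y∈Int , Py = next x x∈U in y , y∈Int , P⇒Q x∈U (proj₁ y∈Int) Py

JStep-cong : {F : Family} {P Q : MH n → Set} (H : MH n) →
  (∀ {x y} → x ∈ Unmarked H → y ∈ Unmarked (H ⁺ x) → P ((H ⁺ x) ⁻ y) ⇔ Q ((H ⁺ x) ⁻ y)) →
  JStep F P H ⇔ JStep F Q H
JStep-cong {F = F} {P} {Q} H P⇔Q = mk⇔
  (JStep-map {F = F} {P} {Q} H λ x∈U y∈U⁺ → Equivalence.to (P⇔Q x∈U y∈U⁺))
  (JStep-map {F = F} {Q} {P} H λ x∈U y∈U⁺ → Equivalence.from (P⇔Q x∈U y∈U⁺))

JStep-J₁⇔J₁-⊎obs : ExcludedMiddle 0ℓ → (F G : Family) → G ⊆ᶠ (F ⊎obs G) → (H : MH n) →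
  (∀ {x y} → x ∈ Unmarked H → y ∈ Unmarked (H ⁺ x) → 2 ≤ ∣ Unmarked ((H ⁺ x) ⁻ y) ∣) →
  JStep F (J 1 G) H ⇔ J 1 (F ⊎obs G) H
JStep-J₁⇔J₁-⊎obs em F G G⊆ H big = mk⇔ forward backward
  where
  forward : JStep F (J 1 G) H → J 1 (F ⊎obs G) H
  forward next x x∈U = let y , (y∈U⁺ , y∈F) , J₁G = next x x∈U in y , y∈U⁺ , λ where
    X (X⊑H , x∈X , _ , D , d , inj₁ D∈F   , i) → y∈F X (X⊑H , x∈X , _ , D , d , D∈F , i)
    X (X⊑H , x∈X , _ , D , d , inj₂ D∈obs , i) → J₁-move⇒obs∋y G H J₁G (X⊑H , x∈X , _ , D , d , D∈obs , i)
  backward : J 1 (F ⊎obs G) H → JStep F (J 1 G) H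
  backward J₁ x x∈U =
    y , (y∈U⁺ , λ X (X⊑H , x∈X , inF) → y∈all X (X⊑H , x∈X , InFam-mono {F} {F ⊎obs G} (λ _ _ → inj₁) inF)) ,
    J₁-move (big x∈U y∈U⁺)
    where open Backward em F G G⊆ H J₁ x∈U

J⇔J₁-star : ExcludedMiddle 0ℓ → (F : Family) (k : ℕ) (H : MH n) → 2 * suc k ≤ ∣ Unmarked H ∣ →
  J (suc k) F H ⇔ J 1 (star k F) H
J⇔J₁-star em F zero    H _   = ⇔.refl
J⇔J₁-star em F (suc k) H big = ⇔.trans
  (JStep-cong {F = F} {P = J (suc k) F} {Q = J 1 (star k F)} H
    λ x∈U y∈U⁺ → J⇔J₁-star em F k _ (shrink x∈U y∈U⁺))
  (JStep-J₁⇔J₁-⊎obs em F (star k F) (star-⊆ᶠ-suc F k) H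
    (λ x∈U y∈U⁺ → ≤-trans (*-monoʳ-≤ 2 (s≤s z≤n)) (shrink x∈U y∈U⁺)))
  where
  shrink : ∀ {x y} → x ∈ Unmarked H → y ∈ Unmarked (H ⁺ x) → 2 * suc k ≤ ∣ Unmarked ((H ⁺ x) ⁻ y) ∣
  shrink x∈U y∈U⁺ = +-cancelˡ-≤ 2 _ _ (subst₂ _≤_ (*-suc 2 (suc k)) (∣Unmarked∣-move H x∈U y∈U⁺) big)

mainTheorem14 : ExcludedMiddle 0ℓ → (F : Family) → IsDangerFamily F →
    (r : ℕ) → 1 ≤ r → ∀ {n} (H : MH n) → IsMH H → 2 * r ≤ ∣ Unmarked H ∣ →
    (J r F H ⇔ J 1 (star (r ∸ 1) F) H)
mainTheorem14 em F _ (suc k) _ H _ big = J⇔J₁-star em F k H big
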